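{- Let $\ell, m, n$ be positive integers with $\ell \leq m$ and $n \geq 3m-2$, let $H = K_{\ell,m}$, and let $G$ be a Gallai coloring of $K_n$ containing no monochromatic copy of $H$. Then in any Gallai partition of $G$, any largest part of the partition has order either at most $\ell - 1$ or at least $n - 2\ell + 2$.
   Context: A Gallai coloring is an edge-coloring (with any number of colors) of a complete graph containing no rainbow triangle (a triangle with three distinct edge colors). A Gallai partition of such a coloring is a partition of the vertex set into at least two parts such that between any two parts all edges have a single color, and in total at most two colors appear on edges between different parts. $K_{\ell,m}$ is the complete bipartite graph with parts of sizes $\ell$ and $m$. -}

module Defs where

open import Data.Nat using (ℕ; suc; _≤_; _<_)
open import Data.Fin using (Fin)
open import Data.Fin.Properties using (_≟_)
open import Data.List using (length; filter)
open import Data.List.Base using (allFin)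
open import Data.Product using (Σ; ∃; _×_; _,_)
open import Data.Sum using (_⊎_)
open import Relation.Binary.PropositionalEquality using (_≡_; _≢_)
open import Relation.Nullary using (¬_)
open import Function.Definitions using (Injective; Surjective)

-- An edge-colouring of K_n with arbitrarily many colours (colours are ℕ).
-- Only values c i j with i ≢ j are meaningful; symmetry is required.
Coloring : ℕ → Set
Coloring n = Fin n → Fin n → ℕ

Symmetric : ∀ {n} → Coloring n → Set
Symmetric {n} c = ∀ (i j : Fin n) → c i j ≡ c j i

RainbowTriangle : ∀ {n} → Coloring n → Fin n → Fin n → Fin n → Set
RainbowTriangle c i j k =
  i ≢ j × j ≢ k × i ≢ k × c i j ≢ c j k × c j k ≢ c i k × c i j ≢ c i k

IsGallai : ∀ {n} → Coloring n → Set
IsGallai {n} c = Symmetric c × (∀ (i j k : Fin n) → ¬ RainbowTriangle c i j k)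

MonoKlm : ∀ {n} → Coloring n → ℕ → ℕ → Set
MonoKlm {n} c ℓ m =
  Σ (Fin ℓ → Fin n) λ A → Σ (Fin m → Fin n) λ B → Σ ℕ λ col →
    Injective _≡_ _≡_ A × Injective _≡_ _≡_ B ×
    (∀ a b → A a ≢ B b) × (∀ a b → c (A a) (B b) ≡ col)

IsGallaiPartition : ∀ {n k} → Coloring n → (Fin n → Fin k) → Set
IsGallaiPartition {n} {k} c p =
  2 ≤ k ×
  Surjective _≡_ _≡_ p ×
  (∀ (s t : Fin k) → s ≢ t → Σ ℕ λ d →
      ∀ (u v : Fin n) → p u ≡ s → p v ≡ t → c u v ≡ d) ×
  (Σ ℕ λ r → Σ ℕ λ b →
      ∀ (u v : Fin n) → p u ≢ p v → (c u v ≡ r ⊎ c u v ≡ b))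

partSize : ∀ {n k} → (Fin n → Fin k) → Fin k → ℕ
partSize {n} p s = length (filter (λ u → p u ≟ s) (allFin n))

IsLargestPart : ∀ {n k} → (Fin n → Fin k) → Fin k → Set
IsLargestPart {n} {k} p s = ∀ (t : Fin k) → partSize p t ≤ partSize p s

module Submission where

-- Fix a Gallai partition of the colouring and a part S of size a
-- (the argument works for every part, not only a largest one).  Edges from S to
-- another part all have one colour, and only two colours r, b occur between
-- parts, so the vertices outside S split into a set R joined to S entirely in
-- colour r and a set B joined to S entirely in colour b; a + |R| + |B| = n.
-- Each of the pairs (S, R), (S, B) is a monochromatic complete bipartite graph,
-- so without a monochromatic K_{ℓ,m}:
--   * if a ≥ m, then |R|, |B| ≤ ℓ - 1, hence a ≥ n - 2ℓ + 2;
--   * if ℓ ≤ a < m, then |R|, |B| ≤ m - 1 and n ≤ 3m - 3, contradicting n ≥ 3m - 2;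
--   * otherwise a ≤ ℓ - 1.
-- The file first builds embeddings of K_{ℓ,m} from duplicate-free lists of
-- vertices (MonoPair), then derives the split (S, R, B) of a Gallai partition
-- (StarSplit, part-split), bounds the part using the counting argument above
-- (split-bound), and finally reads off the theorem.

open import Defs
open import Data.Nat using (ℕ; _≤_; _<_; _+_; _*_; _∸_; s≤s; z≤n; _≤?_)
open import Data.Nat.Properties
  using (≰⇒>; +-mono-≤; +-monoˡ-≤; +-cancelʳ-≤; m≤n+o⇒m∸n≤o; +-suc; module ≤-Reasoning)
import Data.Nat.Properties as ℕ
open import Data.Nat.Tactic.RingSolver using (solve-∀)
open import Data.Fin using (Fin; zero; suc; inject≤)
open import Data.Fin.Properties using (_≟_; inject≤-injective)
open import Data.List using (List; []; _∷_; length; filter; lookup)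
open import Data.List.Base using (allFin)
open import Data.List.Properties using (length-tabulate)
open import Data.List.Membership.Propositional using (_∈_)
open import Data.List.Membership.Propositional.Properties using (∈-filter⁻; ∈-lookup)
open import Data.List.Relation.Unary.All as All using ()
open import Data.List.Relation.Unary.AllPairs using (_∷_)
open import Data.List.Relation.Unary.Unique.Propositional using (Unique)
open import Data.List.Relation.Unary.Unique.Propositional.Properties using (allFin⁺; filter⁺)
open import Data.Product using (_×_; _,_; proj₁; proj₂)
open import Data.Sum using (_⊎_; inj₁; inj₂)
open import Data.Bool using (true; false)
open import Data.Empty using (⊥; ⊥-elim)
open import Relation.Binary.PropositionalEquality using (_≡_; _≢_; refl; sym; trans; cong; subst; module ≡-Reasoning)
open import Relation.Nullary using (¬_; yes; no; does)
open import Relation.Unary using (Pred; Decidable)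
open import Relation.Unary.Properties using (∁?)
open import Function.Definitions using (Injective)

length-filter-∁ : ∀ {A : Set} {p} {P : Pred A p} (P? : Decidable P) (xs : List A) →
                  length (filter P? xs) + length (filter (∁? P?) xs) ≡ length xs
length-filter-∁ P? [] = refl
length-filter-∁ P? (x ∷ xs) with does (P? x)
... | true  = cong ℕ.suc (length-filter-∁ P? xs)
... | false = trans (+-suc _ _) (cong ℕ.suc (length-filter-∁ P? xs))

lookup-injective : ∀ {A : Set} {xs : List A} → Unique xs → Injective _≡_ _≡_ (lookup xs)
lookup-injective (_ ∷ _)    {zero}  {zero}  _  = refl
lookup-injective (x∉xs ∷ _) {zero}  {suc j} eq = ⊥-elim (All.lookup x∉xs (∈-lookup j) eq)
lookup-injective (x∉xs ∷ _) {suc i} {zero}  eq = ⊥-elim (All.lookup x∉xs (∈-lookup i) (sym eq))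
lookup-injective (_ ∷ u)    {suc i} {suc j} eq = cong suc (lookup-injective u eq)

select : ∀ {A : Set} {k} (xs : List A) → k ≤ length xs → Fin k → A
select xs k≤ i = lookup xs (inject≤ i k≤)

select-injective : ∀ {A : Set} {k} {xs : List A} (k≤ : k ≤ length xs) →
                   Unique xs → Injective _≡_ _≡_ (select xs k≤)
select-injective k≤ u {i} {j} eq = inject≤-injective k≤ k≤ i j (lookup-injective u eq)

record MonoPair {n} (c : Coloring n) (col : ℕ) (X Y : List (Fin n)) : Set where
  field
    uniqueˣ  : Unique X
    uniqueʸ  : Unique Y
    disjoint : ∀ {x y} → x ∈ X → y ∈ Y → x ≢ y
    colour   : ∀ {x y} → x ∈ X → y ∈ Y → c x y ≡ col

mono-swap : ∀ {n} {c : Coloring n} {col X Y} → Symmetric c → MonoPair c col X Y → MonoPair c col Y X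
mono-swap symmetric P = record
  { uniqueˣ  = uniqueʸ
  ; uniqueʸ  = uniqueˣ
  ; disjoint = λ y∈Y x∈X y≡x → disjoint x∈X y∈Y (sym y≡x)
  ; colour   = λ y∈Y x∈X → trans (symmetric _ _) (colour x∈X y∈Y)
  }
  where open MonoPair P

mono-embed : ∀ {n} {c : Coloring n} {col X Y} {ℓ m} → MonoPair c col X Y →
             ℓ ≤ length X → m ≤ length Y → MonoKlm c ℓ m
mono-embed {X = X} {Y} P ℓ≤ m≤ =
  select X ℓ≤ , select Y m≤ , _ ,
  select-injective ℓ≤ uniqueˣ , select-injective m≤ uniqueʸ ,
  (λ a b → disjoint (∈-lookup _) (∈-lookup _)) ,
  (λ a b → colour (∈-lookup _) (∈-lookup _))
  where open MonoPair P

Y-short : ∀ {n} {c : Coloring n} {col X Y} {ℓ m} → ¬ MonoKlm c ℓ m →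
          MonoPair c col X Y → ℓ ≤ length X → length Y < m
Y-short noMono P ℓ≤X = ≰⇒> λ m≤Y → noMono (mono-embed P ℓ≤X m≤Y)

X-short : ∀ {n} {c : Coloring n} {col X Y} {ℓ m} → ¬ MonoKlm c ℓ m →
          MonoPair c col X Y → m ≤ length Y → length X < ℓ
X-short noMono P m≤Y = ≰⇒> λ ℓ≤X → noMono (mono-embed P ℓ≤X m≤Y)

record StarSplit {n} (c : Coloring n) (L : List (Fin n)) : Set where
  field
    red blue               : List (Fin n)
    redColour blueColour   : ℕ
    toRed                  : MonoPair c redColour L red
    toBlue                 : MonoPair c blueColour L blue
    total                  : length L + (length red + length blue) ≡ n

part : ∀ {n k} → (Fin n → Fin k) → Fin k → List (Fin n)
part {n} p s = filter (λ u → p u ≟ s) (allFin n)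

-- Every part S of a Gallai partition splits the other vertices as above:
-- an outside vertex sees S in the colour it has to a fixed representative u₀,
-- and that colour is one of the two colours used between parts.
part-split : ∀ {n k} {c : Coloring n} {p : Fin n → Fin k} →
             IsGallaiPartition c p → (s : Fin k) → StarSplit c (part p s)
part-split {n} {c = c} {p} (_ , surjective , uniform , r , b , twoColours) s = record
  { red = red ; blue = blue ; redColour = r ; blueColour = b
  ; toRed  = star (filter⁺ isRed? uniqueOutside) ∈red
  ; toBlue = star (filter⁺ (∁? isRed?) uniqueOutside) ∈blue
  ; total  = total
  }
  where
  u₀ : Fin n
  u₀ = proj₁ (surjective s)

  pu₀ : p u₀ ≡ s
  pu₀ = proj₂ (surjective s) refl

  inS? : Decidable (λ u → p u ≡ s)
  inS? u = p u ≟ s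

  isRed? : Decidable (λ v → c u₀ v ≡ r)
  isRed? v = c u₀ v ℕ.≟ r

  outside red blue : List (Fin n)
  outside = filter (∁? inS?) (allFin n)
  red     = filter isRed? outside
  blue    = filter (∁? isRed?) outside

  uniqueOutside : Unique outside
  uniqueOutside = filter⁺ (∁? inS?) (allFin⁺ n)

  ∈part : ∀ {x} → x ∈ part p s → p x ≡ s
  ∈part x∈ = proj₂ (∈-filter⁻ inS? {xs = allFin n} x∈)

  ∈outside : ∀ {y} → y ∈ outside → p y ≢ s
  ∈outside y∈ = proj₂ (∈-filter⁻ (∁? inS?) {xs = allFin n} y∈)

  ∈red : ∀ {y} → y ∈ red → p y ≢ s × c u₀ y ≡ r
  ∈red y∈ with ∈-filter⁻ isRed? {xs = outside} y∈
  ... | y∈out , red-y = ∈outside y∈out , red-y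

  ∈blue : ∀ {y} → y ∈ blue → p y ≢ s × c u₀ y ≡ b
  ∈blue y∈ with ∈-filter⁻ (∁? isRed?) {xs = outside} y∈
  ... | y∈out , not-red with twoColours u₀ _ (λ e → ∈outside y∈out (trans (sym e) pu₀))
  ...   | inj₁ red-y  = ⊥-elim (not-red red-y)
  ...   | inj₂ blue-y = ∈outside y∈out , blue-y

  -- edges between two parts have one colour, so x ∈ S sees y as u₀ does
  as-representative : ∀ {x y} → p x ≡ s → p y ≢ s → c x y ≡ c u₀ y
  as-representative {x} {y} px py with uniform s (p y) (λ e → py (sym e))
  ... | _ , mono = trans (mono x y px refl) (sym (mono u₀ y pu₀ refl))

  star : ∀ {Y col} → Unique Y → (∀ {y} → y ∈ Y → p y ≢ s × c u₀ y ≡ col) →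
         MonoPair c col (part p s) Y
  star uniqueY seen = record
    { uniqueˣ  = filter⁺ inS? (allFin⁺ n)
    ; uniqueʸ  = uniqueY
    ; disjoint = λ x∈S y∈Y x≡y → proj₁ (seen y∈Y) (subst (λ v → p v ≡ s) x≡y (∈part x∈S))
    ; colour   = λ x∈S y∈Y → trans (as-representative (∈part x∈S) (proj₁ (seen y∈Y)))
                                   (proj₂ (seen y∈Y))
    }

  total : length (part p s) + (length red + length blue) ≡ n
  total = begin
    length (part p s) + (length red + length blue)
      ≡⟨ cong (length (part p s) +_) (length-filter-∁ isRed? outside) ⟩
    length (part p s) + length outside
      ≡⟨ length-filter-∁ inS? (allFin n) ⟩
    length (allFin n)
      ≡⟨ length-tabulate _ ⟩
    n ∎
    where open ≡-Reasoning

two-short : ∀ {ℓ a ρ β} → ρ < ℓ → β < ℓ → a + (ρ + β) + 2 ≤ 2 * ℓ + a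
two-short {ℓ} {a} {ρ} {β} ρ<ℓ β<ℓ = begin
  a + (ρ + β) + 2            ≡⟨ rearrange a ρ β ⟩
  (1 + ρ) + (1 + β) + 0 + a  ≤⟨ +-monoˡ-≤ a (+-mono-≤ (+-mono-≤ ρ<ℓ β<ℓ) z≤n) ⟩
  ℓ + ℓ + 0 + a              ≡⟨ cong (_+ a) (double ℓ) ⟩
  2 * ℓ + a                  ∎
  where
  open ≤-Reasoning
  rearrange : ∀ a ρ β → a + (ρ + β) + 2 ≡ (1 + ρ) + (1 + β) + 0 + a
  rearrange = solve-∀
  double : ∀ ℓ → ℓ + ℓ + 0 ≡ 2 * ℓ
  double = solve-∀

three-short : ∀ {m a ρ β} → a < m → ρ < m → β < m → 3 * m ≤ a + (ρ + β) + 2 → ⊥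
three-short {m} {a} {ρ} {β} a<m ρ<m β<m 3m≤ = 3≰2 (+-cancelʳ-≤ (a + (ρ + β)) 3 2 (begin
  3 + (a + (ρ + β))             ≡⟨ rearrange a ρ β ⟩
  (1 + a) + ((1 + ρ) + (1 + β)) ≤⟨ +-mono-≤ a<m (+-mono-≤ ρ<m β<m) ⟩
  m + (m + m)                   ≡⟨ triple m ⟩
  3 * m                         ≤⟨ 3m≤ ⟩
  a + (ρ + β) + 2               ≡⟨ ℕ.+-comm (a + (ρ + β)) 2 ⟩
  2 + (a + (ρ + β))             ∎))
  where
  open ≤-Reasoning
  rearrange : ∀ a ρ β → 3 + (a + (ρ + β)) ≡ (1 + a) + ((1 + ρ) + (1 + β))
  rearrange = solve-∀
  triple : ∀ m → m + (m + m) ≡ 3 * m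
  triple = solve-∀
  3≰2 : ¬ 3 ≤ 2
  3≰2 (s≤s (s≤s ()))

split-bound : ∀ {n} {c : Coloring n} {L : List (Fin n)} {ℓ m} →
              Symmetric c → ¬ MonoKlm c ℓ m → 3 * m ≤ n + 2 →
              StarSplit c L → ℓ ≤ length L → n + 2 ≤ 2 * ℓ + length L
split-bound {L = L} {ℓ} {m} symmetric noMono 3m≤n+2 split ℓ≤L with m ≤? length L
... | yes m≤L = subst (λ t → t + 2 ≤ 2 * ℓ + length L) total
  (two-short (X-short noMono (mono-swap symmetric toRed) m≤L)
             (X-short noMono (mono-swap symmetric toBlue) m≤L))
  where open StarSplit split
... | no m≰L = ⊥-elim (three-short (≰⇒> m≰L)
  (Y-short noMono toRed ℓ≤L) (Y-short noMono toBlue ℓ≤L)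
  (subst (λ t → 3 * m ≤ t + 2) (sym total) 3m≤n+2))
  where open StarSplit split

below-∸1 : ∀ {a ℓ} → a < ℓ → a ≤ ℓ ∸ 1
below-∸1 (s≤s a≤) = a≤

lemma11 : (ℓ m n : ℕ) → 1 ≤ ℓ → ℓ ≤ m → 3 * m ≤ n + 2 →
    (c : Coloring n) → IsGallai c → ¬ MonoKlm c ℓ m →
    (k : ℕ) (p : Fin n → Fin k) → IsGallaiPartition c p →
    (s : Fin k) → IsLargestPart p s →
    (partSize p s ≤ ℓ ∸ 1) ⊎ (n + 2 ∸ 2 * ℓ ≤ partSize p s)
lemma11 ℓ m n _ _ 3m≤n+2 c (symmetric , _) noMono k p partition s _
  with ℓ ≤? partSize p s
... | no ℓ≰S  = inj₁ (below-∸1 (≰⇒> ℓ≰S))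
... | yes ℓ≤S = inj₂ (m≤n+o⇒m∸n≤o (n + 2) (2 * ℓ)
                  (split-bound symmetric noMono 3m≤n+2 (part-split partition s) ℓ≤S))
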